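{- Let $p$ be an odd prime, $a\in\mathbb{Z}_p$ with $a\not\equiv-1\pmod p$, and for $x\in\mathbb{Z}_p$ let $C_p(x)=\sum_{k=0}^{p-1}(x-2k)\binom xk^3$. Then $$C_p(a)+C_p(a+1)\equiv\frac{2(a-\langle a\rangle_p)^3}{(\langle a\rangle_p+1)^2}\pmod{p^4}.$$
   Context: $\mathbb{Z}_p$ denotes the set of rational numbers whose denominator is not divisible by $p$; congruences are taken in $\mathbb{Z}_p$. For $a\in\mathbb{Z}_p$, $\langle a\rangle_p$ is the unique integer in $\{0,1,\dots,p-1\}$ with $a\equiv\langle a\rangle_p\pmod p$. The general binomial coefficient is $\binom a0=1$, $\binom ak=a(a-1)\cdots(a-k+1)/k!$ for $k\ge1$. -}

module Defs where

open import Data.Nat as ℕ using (ℕ; zero; suc; _^_)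
open import Data.Nat.Divisibility using (_∣_)
open import Data.Integer as ℤ using (ℤ; +_; -[1+_])
open import Data.Rational as ℚ using (ℚ; ↧ₙ_; _/_; _+_; _*_; _-_; 0ℚ; 1ℚ)
open import Data.Product using (Σ; _×_)
open import Relation.Nullary using (¬_)
open import Relation.Binary.PropositionalEquality using (_≡_)

ℕtoℚ : ℕ → ℚ
ℕtoℚ n = (+ n) / 1

InZp : ℕ → ℚ → Set
InZp p q = ¬ (p ∣ ↧ₙ q)

CongMod : ℕ → ℕ → ℚ → ℚ → Set
CongMod p k a b = Σ ℚ (λ c → InZp p c × (a - b ≡ ℕtoℚ (p ^ k) * c))

binom : ℚ → ℕ → ℚ
binom a zero = 1ℚ
binom a (suc k) = binom a k * (a - ℕtoℚ k) * ((+ 1) / suc k)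

sumBelow : ℕ → (ℕ → ℚ) → ℚ
sumBelow zero f = 0ℚ
sumBelow (suc n) f = sumBelow n f + f n

Cp : ℕ → ℚ → ℚ
Cp p x = sumBelow p (λ k → (x - ℕtoℚ (2 ℕ.* k)) * (binom x k * binom x k * binom x k))

-- Summing C_p(a) + C_p(a+1) termwise telescopes:
-- Σ_{k≤n} ((a−2k)·C(a,k)³ + (a+1−2k)·C(a+1,k)³) = (2a+1−n)·C(a,n)³, so the left side is
-- (2a+2−p)·C(a,p−1)³. For a ≡ r (mod p) with r ≤ p−2, the factor (a−r)/(r+1) of C(a,p−1) is
-- divisible by p, while the other factors, each numerator paired with the denominator it is
-- congruent to, multiply to some u ≡ 1 (mod p). Then the left side minus the right side is
-- (a−r)³ (r+1)⁻² ((2a+2−p)(r+1)⁻¹ u³ − 2), a product of four multiples of p.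
module Submission where

open import Defs
open import Data.Nat as ℕ using (ℕ; zero; suc; _<_; _∸_)
open import Data.Nat.Primality using (Prime; euclidsLemma; ¬prime[1])
open import Data.Nat.Divisibility as ℕ∣ using (_∣_; divides)
open import Data.Nat.Coprimality as Coprime using ()
import Data.Nat.Properties as ℕₚ
open import Data.Integer as ℤ using (ℤ; +_; -[1+_])
import Data.Integer.Properties as ℤₚ
open import Data.Integer.GCD using (gcd)
open import Data.Rational as ℚ using (ℚ; mkℚ; ↧ₙ_; _/_; _+_; _*_; _-_; -_; 0ℚ; 1ℚ)
open import Data.Rational.Properties
  using ( _≟_; +-*-commutativeRing; normalize-coprime; /-cong; ↧-/; ↧-neg; *-inverseˡ
        ; +-identityʳ; +-inverseʳ; *-identityʳ; *-assoc; *-comm; *-zeroʳ; *-distribˡ-+; neg-distribʳ-* )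
open import Data.Product using (Σ; _×_; _,_)
open import Data.Sum using (inj₁; inj₂)
open import Level using (0ℓ)
open import Relation.Nullary using (¬_)
open import Relation.Nullary.Decidable using (dec⇒maybe)
open import Relation.Binary.PropositionalEquality
open import Tactic.RingSolver using (solve-∀)
open import Tactic.RingSolver.Core.AlmostCommutativeRing using (AlmostCommutativeRing; fromCommutativeRing)

ℚ-ring : AlmostCommutativeRing 0ℓ 0ℓ
ℚ-ring = fromCommutativeRing +-*-commutativeRing (λ x → dec⇒maybe (0ℚ ≟ x))

ℕtoℚ≡mkℚ : ∀ n → ℕtoℚ n ≡ mkℚ (+ n) 0 (Coprime.sym (Coprime.1-coprimeTo n))
ℕtoℚ≡mkℚ n = normalize-coprime (Coprime.sym (Coprime.1-coprimeTo n))

ℕtoℚ-+ : ∀ m n → ℕtoℚ (m ℕ.+ n) ≡ ℕtoℚ m + ℕtoℚ n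
ℕtoℚ-+ m n = begin
  ℕtoℚ (m ℕ.+ n)                ≡⟨ /-cong (sym (cong₂ ℤ._+_ (ℤₚ.*-identityʳ (+ m)) (ℤₚ.*-identityʳ (+ n)))) refl ⟩
  (+ m ℤ.* + 1 ℤ.+ + n ℤ.* + 1) / 1 ≡⟨ sym (cong₂ _+_ (ℕtoℚ≡mkℚ m) (ℕtoℚ≡mkℚ n)) ⟩
  ℕtoℚ m + ℕtoℚ n               ∎
  where open ≡-Reasoning

ℕtoℚ-* : ∀ m n → ℕtoℚ (m ℕ.* n) ≡ ℕtoℚ m * ℕtoℚ n
ℕtoℚ-* m n = begin
  ℕtoℚ (m ℕ.* n)      ≡⟨ /-cong (ℤₚ.pos-* m n) refl ⟩
  (+ m ℤ.* + n) / 1   ≡⟨ sym (cong₂ _*_ (ℕtoℚ≡mkℚ m) (ℕtoℚ≡mkℚ n)) ⟩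
  ℕtoℚ m * ℕtoℚ n     ∎
  where open ≡-Reasoning

ℕtoℚ-suc : ∀ n → ℕtoℚ (suc n) ≡ 1ℚ + ℕtoℚ n
ℕtoℚ-suc = ℕtoℚ-+ 1

1/[1+_] : ℕ → ℚ
1/[1+ n ] = + 1 / suc n

1/[1+n]*[1+n]≡1 : ∀ n → 1/[1+ n ] * (1ℚ + ℕtoℚ n) ≡ 1ℚ
1/[1+n]*[1+n]≡1 n = begin
  1/[1+ n ] * (1ℚ + ℕtoℚ n)
    ≡⟨ cong₂ _*_ (normalize-coprime (Coprime.1-coprimeTo (suc n))) (trans (sym (ℕtoℚ-suc n)) (ℕtoℚ≡mkℚ (suc n))) ⟩
  _ ≡⟨ *-inverseˡ (mkℚ (+ suc n) 0 (Coprime.sym (Coprime.1-coprimeTo (suc n)))) ⟩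
  1ℚ ∎
  where open ≡-Reasoning

cube : ℚ → ℚ
cube x = x * x * x

productBelow : ℕ → (ℕ → ℚ) → ℚ
productBelow zero    f = 1ℚ
productBelow (suc n) f = productBelow n f * f n

productBelow-cong : ∀ n {f g} → (∀ i → f i ≡ g i) → productBelow n f ≡ productBelow n g
productBelow-cong zero    f≗g = refl
productBelow-cong (suc n) f≗g = cong₂ _*_ (productBelow-cong n f≗g) (f≗g n)

productBelow-* : ∀ n f g → productBelow n (λ i → f i * g i) ≡ productBelow n f * productBelow n g
productBelow-* zero    f g = refl
productBelow-* (suc n) f g = begin
  productBelow n (λ i → f i * g i) * (f n * g n)      ≡⟨ cong (_* (f n * g n)) (productBelow-* n f g) ⟩
  productBelow n f * productBelow n g * (f n * g n)   ≡⟨ interchange (productBelow n f) (productBelow n g) (f n) (g n) ⟩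
  productBelow n f * f n * (productBelow n g * g n)   ∎
  where
    open ≡-Reasoning
    interchange : ∀ w x y z → w * x * (y * z) ≡ w * y * (x * z)
    interchange = solve-∀ ℚ-ring

productBelow-suc : ∀ n f → productBelow (suc n) f ≡ f 0 * productBelow n (λ i → f (suc i))
productBelow-suc zero    f = *-comm 1ℚ (f 0)
productBelow-suc (suc n) f = trans (cong (_* f (suc n)) (productBelow-suc n f))
                                   (*-assoc (f 0) _ (f (suc n)))

productBelow-+ : ∀ m n f → productBelow (m ℕ.+ n) f ≡ productBelow m f * productBelow n (λ i → f (m ℕ.+ i))
productBelow-+ m zero    f = trans (cong (λ k → productBelow k f) (ℕₚ.+-identityʳ m)) (sym (*-identityʳ _))
productBelow-+ m (suc n) f = begin
  productBelow (m ℕ.+ suc n) f                                        ≡⟨ cong (λ k → productBelow k f) (ℕₚ.+-suc m n) ⟩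
  productBelow (m ℕ.+ n) f * f (m ℕ.+ n)                              ≡⟨ cong (_* f (m ℕ.+ n)) (productBelow-+ m n f) ⟩
  productBelow m f * productBelow n (λ i → f (m ℕ.+ i)) * f (m ℕ.+ n) ≡⟨ *-assoc (productBelow m f) _ _ ⟩
  productBelow m f * productBelow (suc n) (λ i → f (m ℕ.+ i))        ∎
  where open ≡-Reasoning

productBelow-falling : ∀ m x (w : ℕ → ℚ) →
  productBelow (suc m) (λ i → (x - ℕtoℚ i) * w i) ≡ x * w m * productBelow m (λ i → (x - 1ℚ - ℕtoℚ i) * w i)
productBelow-falling m x w = begin
  productBelow (suc m) (λ i → (x - ℕtoℚ i) * w i)
    ≡⟨ productBelow-* (suc m) (λ i → x - ℕtoℚ i) w ⟩
  productBelow (suc m) (λ i → x - ℕtoℚ i) * (productBelow m w * w m)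
    ≡⟨ cong (_* (productBelow m w * w m)) (productBelow-suc m (λ i → x - ℕtoℚ i)) ⟩
  (x - ℕtoℚ 0) * productBelow m (λ i → x - ℕtoℚ (suc i)) * (productBelow m w * w m)
    ≡⟨ cong (λ t → (x - ℕtoℚ 0) * t * (productBelow m w * w m)) (productBelow-cong m x-[1+i]≡) ⟩
  (x - ℕtoℚ 0) * productBelow m (λ i → x - 1ℚ - ℕtoℚ i) * (productBelow m w * w m)
    ≡⟨ regroup x (productBelow m (λ i → x - 1ℚ - ℕtoℚ i)) (productBelow m w) (w m) ⟩
  x * w m * (productBelow m (λ i → x - 1ℚ - ℕtoℚ i) * productBelow m w)
    ≡⟨ cong (x * w m *_) (sym (productBelow-* m (λ i → x - 1ℚ - ℕtoℚ i) w)) ⟩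
  x * w m * productBelow m (λ i → (x - 1ℚ - ℕtoℚ i) * w i) ∎
  where
    open ≡-Reasoning
    shift : ∀ x i → x - (1ℚ + i) ≡ x - 1ℚ - i
    shift = solve-∀ ℚ-ring
    x-[1+i]≡ : ∀ i → x - ℕtoℚ (suc i) ≡ x - 1ℚ - ℕtoℚ i
    x-[1+i]≡ i = trans (cong (λ k → x - k) (ℕtoℚ-suc i)) (shift x (ℕtoℚ i))
    regroup : ∀ x A B v → (x - ℕtoℚ 0) * A * (B * v) ≡ x * v * (A * B)
    regroup = solve-∀ ℚ-ring

binomFactor : ℚ → ℕ → ℚ
binomFactor a j = (a - ℕtoℚ j) * 1/[1+ j ]

binom≡productBelow : ∀ a k → binom a k ≡ productBelow k (binomFactor a)
binom≡productBelow a zero    = refl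
binom≡productBelow a (suc k) = trans (*-assoc (binom a k) _ _) (cong (_* binomFactor a k) (binom≡productBelow a k))

binom-absorption : ∀ a n → binom (a + 1ℚ) (suc n) ≡ (a + 1ℚ) * binom a n * 1/[1+ n ]
binom-absorption a zero    = base a 1/[1+ 0 ]
  where
    base : ∀ a w → 1ℚ * (a + 1ℚ - ℕtoℚ 0) * w ≡ (a + 1ℚ) * 1ℚ * w
    base = solve-∀ ℚ-ring
binom-absorption a (suc n) = begin
  binom (a + 1ℚ) (suc n) * (a + 1ℚ - ℕtoℚ (suc n)) * 1/[1+ suc n ]
    ≡⟨ cong₂ (λ b k → b * (a + 1ℚ - k) * 1/[1+ suc n ]) (binom-absorption a n) (ℕtoℚ-suc n) ⟩
  (a + 1ℚ) * binom a n * 1/[1+ n ] * (a + 1ℚ - (1ℚ + ℕtoℚ n)) * 1/[1+ suc n ]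
    ≡⟨ regroup a (binom a n) (ℕtoℚ n) 1/[1+ n ] 1/[1+ suc n ] ⟩
  (a + 1ℚ) * (binom a n * (a - ℕtoℚ n) * 1/[1+ n ]) * 1/[1+ suc n ] ∎
  where
    open ≡-Reasoning
    regroup : ∀ a b n w w′ → (a + 1ℚ) * b * w * (a + 1ℚ - (1ℚ + n)) * w′ ≡ (a + 1ℚ) * (b * (a - n) * w) * w′
    regroup = solve-∀ ℚ-ring

binom-split : ∀ a r m → binom a (suc r ℕ.+ m) ≡
  (a - ℕtoℚ r) * 1/[1+ r ] * (binom a r * productBelow m (λ i → (a - ℕtoℚ (suc r) - ℕtoℚ i) * 1/[1+ suc r ℕ.+ i ]))
binom-split a r m = begin
  binom a (suc r ℕ.+ m)
    ≡⟨ binom≡productBelow a (suc r ℕ.+ m) ⟩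
  productBelow (suc r ℕ.+ m) (binomFactor a)
    ≡⟨ productBelow-+ (suc r) m (binomFactor a) ⟩
  productBelow r (binomFactor a) * binomFactor a r * productBelow m (λ i → binomFactor a (suc r ℕ.+ i))
    ≡⟨ cong₂ (λ b t → b * binomFactor a r * t) (sym (binom≡productBelow a r)) (productBelow-cong m factor≡) ⟩
  binom a r * binomFactor a r * Π
    ≡⟨ regroup (binom a r) (binomFactor a r) Π ⟩
  binomFactor a r * (binom a r * Π) ∎
  where
    open ≡-Reasoning
    Π = productBelow m (λ i → (a - ℕtoℚ (suc r) - ℕtoℚ i) * 1/[1+ suc r ℕ.+ i ])
    minus-+ : ∀ a b c → a - (b + c) ≡ a - b - c
    minus-+ = solve-∀ ℚ-ring
    factor≡ : ∀ i → binomFactor a (suc r ℕ.+ i) ≡ (a - ℕtoℚ (suc r) - ℕtoℚ i) * 1/[1+ suc r ℕ.+ i ]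
    factor≡ i = cong (_* 1/[1+ suc r ℕ.+ i ])
                     (trans (cong (λ k → a - k) (ℕtoℚ-+ (suc r) i)) (minus-+ a (ℕtoℚ (suc r)) (ℕtoℚ i)))
    regroup : ∀ x y z → x * y * z ≡ y * (x * z)
    regroup = solve-∀ ℚ-ring

Cp-term : ℚ → ℕ → ℚ
Cp-term x k = (x - ℕtoℚ (2 ℕ.* k)) * cube (binom x k)

sumBelow-+ : ∀ n f g → sumBelow n f + sumBelow n g ≡ sumBelow n (λ k → f k + g k)
sumBelow-+ zero    f g = +-identityʳ 0ℚ
sumBelow-+ (suc n) f g = begin
  sumBelow n f + f n + (sumBelow n g + g n)     ≡⟨ interchange (sumBelow n f) (f n) (sumBelow n g) (g n) ⟩
  sumBelow n f + sumBelow n g + (f n + g n)     ≡⟨ cong (_+ (f n + g n)) (sumBelow-+ n f g) ⟩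
  sumBelow n (λ k → f k + g k) + (f n + g n)    ∎
  where
    open ≡-Reasoning
    interchange : ∀ w x y z → w + x + (y + z) ≡ w + y + (x + z)
    interchange = solve-∀ ℚ-ring

ℕtoℚ-2* : ∀ n → ℕtoℚ (2 ℕ.* n) ≡ ℕtoℚ n + ℕtoℚ n
ℕtoℚ-2* n = trans (ℕtoℚ-+ n (n ℕ.+ 0)) (cong (λ k → ℕtoℚ n + ℕtoℚ k) (ℕₚ.+-identityʳ n))

Cp-pair-step : ∀ a N B w → w * (1ℚ + N) ≡ 1ℚ →
  (a + a + 1ℚ - N) * cube B
    + ((a - ((1ℚ + N) + (1ℚ + N))) * cube (B * (a - N) * w)
       + (a + 1ℚ - ((1ℚ + N) + (1ℚ + N))) * cube ((a + 1ℚ) * B * w))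
  ≡ (a + a + 1ℚ - (1ℚ + N)) * cube (B * (a - N) * w)
Cp-pair-step a N B w w[1+N]≡1 = begin
  (a + a + 1ℚ - N) * cube B + rest                               ≡⟨ cong (_+ rest) (sym (*-identityʳ ((a + a + 1ℚ - N) * cube B))) ⟩
  (a + a + 1ℚ - N) * cube B * cube 1ℚ + rest                     ≡⟨ cong (λ t → (a + a + 1ℚ - N) * cube B * cube t + rest) (sym w[1+N]≡1) ⟩
  (a + a + 1ℚ - N) * cube B * cube (w * (1ℚ + N)) + rest         ≡⟨ identity a N B w ⟩
  (a + a + 1ℚ - (1ℚ + N)) * cube (B * (a - N) * w)               ∎
  where
    open ≡-Reasoning
    rest = (a - ((1ℚ + N) + (1ℚ + N))) * cube (B * (a - N) * w)
           + (a + 1ℚ - ((1ℚ + N) + (1ℚ + N))) * cube ((a + 1ℚ) * B * w)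
    identity : ∀ a N B w →
      let C = B * (a - N) * w ; D = (a + 1ℚ) * B * w ; E = w * (1ℚ + N) in
      (a + a + 1ℚ - N) * (B * B * B) * (E * E * E)
        + ((a - ((1ℚ + N) + (1ℚ + N))) * (C * C * C) + (a + 1ℚ - ((1ℚ + N) + (1ℚ + N))) * (D * D * D))
      ≡ (a + a + 1ℚ - (1ℚ + N)) * (C * C * C)
    identity = solve-∀ ℚ-ring

Cp-pair-telescope : ∀ a n → sumBelow (suc n) (λ k → Cp-term a k + Cp-term (a + 1ℚ) k)
                            ≡ (a + a + 1ℚ - ℕtoℚ n) * cube (binom a n)
Cp-pair-telescope a zero    = base a
  where
    base : ∀ a → 0ℚ + ((a - 0ℚ) * 1ℚ + (a + 1ℚ - 0ℚ) * 1ℚ) ≡ (a + a + 1ℚ - 0ℚ) * 1ℚ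
    base = solve-∀ ℚ-ring
Cp-pair-telescope a (suc n) = begin
  sumBelow (suc n) (λ k → Cp-term a k + Cp-term (a + 1ℚ) k) + (Cp-term a (suc n) + Cp-term (a + 1ℚ) (suc n))
    ≡⟨ cong₂ (λ s t → s + ((a - t) * cube (binom a (suc n)) + (a + 1ℚ - t) * cube (binom (a + 1ℚ) (suc n))))
             (Cp-pair-telescope a n) (trans (ℕtoℚ-2* (suc n)) (cong (λ k → k + k) (ℕtoℚ-suc n))) ⟩
  (a + a + 1ℚ - N) * cube B
    + ((a - ((1ℚ + N) + (1ℚ + N))) * cube (B * (a - N) * w)
       + (a + 1ℚ - ((1ℚ + N) + (1ℚ + N))) * cube (binom (a + 1ℚ) (suc n)))
    ≡⟨ cong (λ b → (a + a + 1ℚ - N) * cube B + ((a - ((1ℚ + N) + (1ℚ + N))) * cube (B * (a - N) * w)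
                     + (a + 1ℚ - ((1ℚ + N) + (1ℚ + N))) * cube b)) (binom-absorption a n) ⟩
  _ ≡⟨ Cp-pair-step a N B w (1/[1+n]*[1+n]≡1 n) ⟩
  (a + a + 1ℚ - (1ℚ + N)) * cube (B * (a - N) * w)
    ≡⟨ cong (λ k → (a + a + 1ℚ - k) * cube (binom a (suc n))) (sym (ℕtoℚ-suc n)) ⟩
  (a + a + 1ℚ - ℕtoℚ (suc n)) * cube (binom a (suc n)) ∎
  where
    open ≡-Reasoning
    N = ℕtoℚ n
    B = binom a n
    w = 1/[1+ n ]

Cp-pair : ∀ a n → Cp (suc n) a + Cp (suc n) (a + 1ℚ) ≡ (a + a + 1ℚ - ℕtoℚ n) * cube (binom a n)
Cp-pair a n = trans (sumBelow-+ (suc n) (Cp-term a) (Cp-term (a + 1ℚ))) (Cp-pair-telescope a n)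

↧ₙ[i/n]∣n : ∀ (i : ℤ) n .{{_ : ℕ.NonZero n}} → ↧ₙ (i / n) ∣ n
↧ₙ[i/n]∣n i n = divides ℤ.∣ gcd i (+ n) ∣ (begin
  n                                        ≡⟨ sym (cong ℤ.∣_∣ (↧-/ i n)) ⟩
  ℤ.∣ ℚ.↧ (i / n) ℤ.* gcd i (+ n) ∣        ≡⟨ ℤₚ.abs-* (ℚ.↧ (i / n)) (gcd i (+ n)) ⟩
  ↧ₙ (i / n) ℕ.* ℤ.∣ gcd i (+ n) ∣         ≡⟨ ℕₚ.*-comm (↧ₙ (i / n)) _ ⟩
  ℤ.∣ gcd i (+ n) ∣ ℕ.* ↧ₙ (i / n)         ∎)
  where open ≡-Reasoning

-- A record around CongMod, so that x and y can be inferred from the type.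
infix 4 _≡_[mod_^_]
record _≡_[mod_^_] (x y : ℚ) (p k : ℕ) : Set where
  constructor ⟦_⟧
  field congMod : CongMod p k x y

open _≡_[mod_^_] public

module ModPrime (p : ℕ) (p-prime : Prime p) where

  InZp-/ : ∀ (i : ℤ) n .{{_ : ℕ.NonZero n}} → ¬ (p ∣ n) → InZp p (i / n)
  InZp-/ i n p∤n p∣↧ = p∤n (ℕ∣.∣-trans p∣↧ (↧ₙ[i/n]∣n i n))

  InZp-+ : ∀ x y → InZp p x → InZp p y → InZp p (x + y)
  InZp-+ x@(mkℚ _ _ _) y@(mkℚ _ _ _) x∈ y∈ p∣↧
    with euclidsLemma (↧ₙ x) (↧ₙ y) p-prime
           (ℕ∣.∣-trans p∣↧ (↧ₙ[i/n]∣n (ℚ.↥ x ℤ.* ℚ.↧ y ℤ.+ ℚ.↥ y ℤ.* ℚ.↧ x) (↧ₙ x ℕ.* ↧ₙ y)))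
  ... | inj₁ p∣↧x = x∈ p∣↧x
  ... | inj₂ p∣↧y = y∈ p∣↧y

  InZp-* : ∀ x y → InZp p x → InZp p y → InZp p (x * y)
  InZp-* x@(mkℚ _ _ _) y@(mkℚ _ _ _) x∈ y∈ p∣↧
    with euclidsLemma (↧ₙ x) (↧ₙ y) p-prime
           (ℕ∣.∣-trans p∣↧ (↧ₙ[i/n]∣n (ℚ.↥ x ℤ.* ℚ.↥ y) (↧ₙ x ℕ.* ↧ₙ y)))
  ... | inj₁ p∣↧x = x∈ p∣↧x
  ... | inj₂ p∣↧y = y∈ p∣↧y

  InZp-neg : ∀ x → InZp p x → InZp p (- x)
  InZp-neg x x∈ p∣↧ = x∈ (subst (p ∣_) (cong ℤ.∣_∣ (↧-neg x)) p∣↧)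

  InZp-ℕ : ∀ n → InZp p (ℕtoℚ n)
  InZp-ℕ n = InZp-/ (+ n) 1 (λ p∣1 → ¬prime[1] (subst Prime (ℕ∣.∣1⇒≡1 p∣1) p-prime))

  InZp-1/[1+] : ∀ {n} → suc n < p → InZp p 1/[1+ n ]
  InZp-1/[1+] {n} 1+n<p = InZp-/ (+ 1) (suc n) (ℕ∣.>⇒∤ 1+n<p)


  mod-refl : ∀ {k x} → x ≡ x [mod p ^ k ]
  mod-refl {k} {x} = ⟦ 0ℚ , InZp-ℕ 0 , trans (+-inverseʳ x) (sym (*-zeroʳ (ℕtoℚ (p ℕ.^ k)))) ⟧

  mod-sym : ∀ {k x y} → x ≡ y [mod p ^ k ] → y ≡ x [mod p ^ k ]
  mod-sym {k} {x} {y} ⟦ c , c∈ , x-y≡ ⟧ = ⟦ - c , InZp-neg c c∈ , (begin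
    y - x                  ≡⟨ flip x y ⟩
    - (x - y)              ≡⟨ cong -_ x-y≡ ⟩
    - (ℕtoℚ (p ℕ.^ k) * c) ≡⟨ neg-distribʳ-* (ℕtoℚ (p ℕ.^ k)) c ⟩
    ℕtoℚ (p ℕ.^ k) * - c   ∎) ⟧
    where
      open ≡-Reasoning
      flip : ∀ x y → y - x ≡ - (x - y)
      flip = solve-∀ ℚ-ring

  mod-trans : ∀ {k x y z} → x ≡ y [mod p ^ k ] → y ≡ z [mod p ^ k ] → x ≡ z [mod p ^ k ]
  mod-trans {k} {x} {y} {z} ⟦ c , c∈ , x-y≡ ⟧ ⟦ d , d∈ , y-z≡ ⟧ = ⟦ c + d , InZp-+ c d c∈ d∈ , (begin
    x - z             ≡⟨ split x y z ⟩
    (x - y) + (y - z) ≡⟨ cong₂ _+_ x-y≡ y-z≡ ⟩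
    Q * c + Q * d     ≡⟨ sym (*-distribˡ-+ Q c d) ⟩
    Q * (c + d)       ∎) ⟧
    where
      open ≡-Reasoning
      Q = ℕtoℚ (p ℕ.^ k)
      split : ∀ x y z → x - z ≡ (x - y) + (y - z)
      split = solve-∀ ℚ-ring

  mod-reflexive : ∀ {k x y} → x ≡ y → x ≡ y [mod p ^ k ]
  mod-reflexive refl = mod-refl

  mod-+ : ∀ {k x x′ y y′} → x ≡ x′ [mod p ^ k ] → y ≡ y′ [mod p ^ k ] → x + y ≡ x′ + y′ [mod p ^ k ]
  mod-+ {k} {x} {x′} {y} {y′} ⟦ c , c∈ , x-x′≡ ⟧ ⟦ d , d∈ , y-y′≡ ⟧ = ⟦ c + d , InZp-+ c d c∈ d∈ , (begin
    (x + y) - (x′ + y′) ≡⟨ regroup x x′ y y′ ⟩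
    (x - x′) + (y - y′) ≡⟨ cong₂ _+_ x-x′≡ y-y′≡ ⟩
    Q * c + Q * d       ≡⟨ sym (*-distribˡ-+ Q c d) ⟩
    Q * (c + d)         ∎) ⟧
    where
      open ≡-Reasoning
      Q = ℕtoℚ (p ℕ.^ k)
      regroup : ∀ x x′ y y′ → (x + y) - (x′ + y′) ≡ (x - x′) + (y - y′)
      regroup = solve-∀ ℚ-ring

  mod-neg : ∀ {k x x′} → x ≡ x′ [mod p ^ k ] → - x ≡ - x′ [mod p ^ k ]
  mod-neg {k} {x} {x′} ⟦ c , c∈ , x-x′≡ ⟧ = mod-sym ⟦ c , c∈ , trans (regroup x x′) x-x′≡ ⟧
    where
      regroup : ∀ x x′ → - x′ - - x ≡ x - x′
      regroup = solve-∀ ℚ-ring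

  mod-minus : ∀ {k x x′ y y′} → x ≡ x′ [mod p ^ k ] → y ≡ y′ [mod p ^ k ] → x - y ≡ x′ - y′ [mod p ^ k ]
  mod-minus x≡x′ y≡y′ = mod-+ x≡x′ (mod-neg y≡y′)

  mod-*ˡ : ∀ {k x y} w → InZp p w → x ≡ y [mod p ^ k ] → w * x ≡ w * y [mod p ^ k ]
  mod-*ˡ {k} {x} {y} w w∈ ⟦ c , c∈ , x-y≡ ⟧ = ⟦ w * c , InZp-* w c w∈ c∈ , (begin
    w * x - w * y ≡⟨ factor w x y ⟩
    w * (x - y)   ≡⟨ cong (w *_) x-y≡ ⟩
    w * (Q * c)   ≡⟨ swap w Q c ⟩
    Q * (w * c)   ∎) ⟧
    where
      open ≡-Reasoning
      Q = ℕtoℚ (p ℕ.^ k)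
      factor : ∀ w x y → w * x - w * y ≡ w * (x - y)
      factor = solve-∀ ℚ-ring
      swap : ∀ w Q c → w * (Q * c) ≡ Q * (w * c)
      swap = solve-∀ ℚ-ring

  InZp-mod : ∀ {k x y} → InZp p y → x ≡ y [mod p ^ k ] → InZp p x
  InZp-mod {k} {x} {y} y∈ ⟦ c , c∈ , x-y≡ ⟧ =
    subst (InZp p) (sym x≡) (InZp-+ (Q * c) y (InZp-* Q c (InZp-ℕ (p ℕ.^ k)) c∈) y∈)
    where
      Q = ℕtoℚ (p ℕ.^ k)
      shift : ∀ x y → x ≡ (x - y) + y
      shift = solve-∀ ℚ-ring
      x≡ : x ≡ Q * c + y
      x≡ = trans (shift x y) (cong (_+ y) x-y≡)

  mod-* : ∀ {k x x′ y y′} → InZp p x → InZp p y′ →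
           x ≡ x′ [mod p ^ k ] → y ≡ y′ [mod p ^ k ] → x * y ≡ x′ * y′ [mod p ^ k ]
  mod-* {x = x} {x′} {y} {y′} x∈ y′∈ x≡x′ y≡y′ = mod-trans (mod-*ˡ x x∈ y≡y′)
    (subst₂ (λ s t → s ≡ t [mod p ^ _ ]) (*-comm y′ x) (*-comm y′ x′) (mod-*ˡ y′ y′∈ x≡x′))

  mod-*-≡0 : ∀ {j k x y} → x ≡ 0ℚ [mod p ^ j ] → y ≡ 0ℚ [mod p ^ k ] → x * y ≡ 0ℚ [mod p ^ j ℕ.+ k ]
  mod-*-≡0 {j} {k} {x} {y} ⟦ c , c∈ , x-0≡ ⟧ ⟦ d , d∈ , y-0≡ ⟧ = ⟦ c * d , InZp-* c d c∈ d∈ , (begin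
    x * y - 0ℚ                  ≡⟨ drop0 x y ⟩
    (x - 0ℚ) * (y - 0ℚ)         ≡⟨ cong₂ _*_ x-0≡ y-0≡ ⟩
    (Qʲ * c) * (Qᵏ * d)         ≡⟨ interchange Qʲ c Qᵏ d ⟩
    (Qʲ * Qᵏ) * (c * d)         ≡⟨ cong (_* (c * d)) (sym Qʲ⁺ᵏ≡) ⟩
    ℕtoℚ (p ℕ.^ (j ℕ.+ k)) * (c * d) ∎) ⟧
    where
      open ≡-Reasoning
      Qʲ = ℕtoℚ (p ℕ.^ j)
      Qᵏ = ℕtoℚ (p ℕ.^ k)
      Qʲ⁺ᵏ≡ : ℕtoℚ (p ℕ.^ (j ℕ.+ k)) ≡ Qʲ * Qᵏ
      Qʲ⁺ᵏ≡ = trans (cong ℕtoℚ (ℕₚ.^-distribˡ-+-* p j k)) (ℕtoℚ-* (p ℕ.^ j) (p ℕ.^ k))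
      drop0 : ∀ x y → x * y - 0ℚ ≡ (x - 0ℚ) * (y - 0ℚ)
      drop0 = solve-∀ ℚ-ring
      interchange : ∀ a b c d → (a * b) * (c * d) ≡ (a * c) * (b * d)
      interchange = solve-∀ ℚ-ring

  mod-*-≡1 : ∀ {k x y} → x ≡ 1ℚ [mod p ^ k ] → y ≡ 1ℚ [mod p ^ k ] → x * y ≡ 1ℚ [mod p ^ k ]
  mod-*-≡1 x≡1 y≡1 = mod-* (InZp-mod (InZp-ℕ 1) x≡1) (InZp-ℕ 1) x≡1 y≡1

  ℕtoℚ-pred≡-1 : ∀ {n} → suc n ≡ p → ℕtoℚ n ≡ - 1ℚ [mod p ^ 1 ]
  ℕtoℚ-pred≡-1 {n} 1+n≡p = ⟦ 1ℚ , InZp-ℕ 1 , (begin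
    ℕtoℚ n - - 1ℚ          ≡⟨ flip (ℕtoℚ n) ⟩
    1ℚ + ℕtoℚ n            ≡⟨ sym (ℕtoℚ-suc n) ⟩
    ℕtoℚ (suc n)           ≡⟨ cong ℕtoℚ (trans 1+n≡p (sym (ℕₚ.^-identityʳ p))) ⟩
    ℕtoℚ (p ℕ.^ 1)         ≡⟨ sym (*-identityʳ _) ⟩
    ℕtoℚ (p ℕ.^ 1) * 1ℚ    ∎) ⟧
    where
      open ≡-Reasoning
      flip : ∀ n → n - - 1ℚ ≡ 1ℚ + n
      flip = solve-∀ ℚ-ring

  -- The largest numerator x is paired with the largest denominator s + m + 1.
  shiftedFalling≡1 : ∀ m s x → s ℕ.+ m < p → x ≡ ℕtoℚ (s ℕ.+ m) [mod p ^ 1 ] →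
    productBelow m (λ i → (x - ℕtoℚ i) * 1/[1+ s ℕ.+ i ]) ≡ 1ℚ [mod p ^ 1 ]
  shiftedFalling≡1 zero    s x _        _  = mod-refl
  shiftedFalling≡1 (suc m) s x s+m+1<p x≡ =
    subst (λ t → t ≡ 1ℚ [mod p ^ 1 ]) (sym (productBelow-falling m x (λ i → 1/[1+ s ℕ.+ i ])))
      (mod-*-≡1 x*w≡1 (shiftedFalling≡1 m s (x - 1ℚ) s+m<p x-1≡))
    where
      s+m+1≡ : ℕtoℚ (s ℕ.+ suc m) ≡ 1ℚ + ℕtoℚ (s ℕ.+ m)
      s+m+1≡ = trans (cong ℕtoℚ (ℕₚ.+-suc s m)) (ℕtoℚ-suc (s ℕ.+ m))
      s+m<p : s ℕ.+ m < p
      s+m<p = ℕₚ.<-trans (ℕₚ.+-monoʳ-< s (ℕₚ.n<1+n m)) s+m+1<p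
      x*w≡1 : x * 1/[1+ s ℕ.+ m ] ≡ 1ℚ [mod p ^ 1 ]
      x*w≡1 = mod-trans
        (mod-* (InZp-mod (InZp-ℕ (s ℕ.+ suc m)) x≡) (InZp-1/[1+] (subst (_< p) (ℕₚ.+-suc s m) s+m+1<p)) x≡ mod-refl)
        (mod-reflexive (trans (*-comm _ 1/[1+ s ℕ.+ m ])
                              (trans (cong (1/[1+ s ℕ.+ m ] *_) s+m+1≡) (1/[1+n]*[1+n]≡1 (s ℕ.+ m)))))
      cancel : ∀ n → 1ℚ + n - 1ℚ ≡ n
      cancel = solve-∀ ℚ-ring
      x-1≡ : x - 1ℚ ≡ ℕtoℚ (s ℕ.+ m) [mod p ^ 1 ]
      x-1≡ = mod-trans (mod-minus x≡ (mod-refl {x = 1ℚ})) (mod-reflexive (trans (cong (_- 1ℚ) s+m+1≡) (cancel (ℕtoℚ (s ℕ.+ m)))))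

  binom[p-1]-factorisation : ∀ a r m → suc (suc r ℕ.+ m) ≡ p → a ≡ ℕtoℚ r [mod p ^ 1 ] →
    Σ ℚ λ u → u ≡ 1ℚ [mod p ^ 1 ] × binom a (suc r ℕ.+ m) ≡ (a - ℕtoℚ r) * 1/[1+ r ] * u
  binom[p-1]-factorisation a r m p≡ a≡r = _ , mod-*-≡1 binom≡1 Π≡1 , binom-split a r m
    where
      r<p : r < p
      r<p = subst (r <_) p≡ (ℕ.s≤s (ℕₚ.m≤n⇒m≤1+n (ℕₚ.m≤m+n r m)))
      binom≡1 : binom a r ≡ 1ℚ [mod p ^ 1 ]
      binom≡1 = subst (λ t → t ≡ 1ℚ [mod p ^ 1 ]) (sym (binom≡productBelow a r)) (shiftedFalling≡1 r 0 a r<p a≡r)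
      cancel : ∀ r → r - (1ℚ + r) ≡ - 1ℚ
      cancel = solve-∀ ℚ-ring
      a-[1+r]≡ : a - ℕtoℚ (suc r) ≡ ℕtoℚ (suc r ℕ.+ m) [mod p ^ 1 ]
      a-[1+r]≡ = mod-trans (mod-minus a≡r mod-refl)
        (mod-trans (mod-reflexive (trans (cong (λ k → ℕtoℚ r - k) (ℕtoℚ-suc r)) (cancel (ℕtoℚ r))))
                   (mod-sym (ℕtoℚ-pred≡-1 p≡)))
      Π≡1 = shiftedFalling≡1 m (suc r) (a - ℕtoℚ (suc r)) (subst (suc r ℕ.+ m <_) p≡ ℕₚ.≤-refl) a-[1+r]≡

  mod-≡0⇒≡ : ∀ {k x y} → x - y ≡ 0ℚ [mod p ^ k ] → x ≡ y [mod p ^ k ]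
  mod-≡0⇒≡ {x = x} {y} ⟦ c , c∈ , x-y-0≡ ⟧ = ⟦ c , c∈ , trans (sym (drop0 (x - y))) x-y-0≡ ⟧
    where
      drop0 : ∀ z → z - 0ℚ ≡ z
      drop0 = solve-∀ ℚ-ring

  Cp-pair-residue : ∀ {a r N u} → suc r < p →
    a ≡ ℕtoℚ r [mod p ^ 1 ] → N ≡ - 1ℚ [mod p ^ 1 ] → u ≡ 1ℚ [mod p ^ 1 ] →
    (a + a + 1ℚ - N) * cube ((a - ℕtoℚ r) * 1/[1+ r ] * u)
      ≡ ℕtoℚ 2 * cube (a - ℕtoℚ r) * (1/[1+ r ] * 1/[1+ r ]) [mod p ^ 4 ]
  Cp-pair-residue {a} {r} {N} {u} 1+r<p a≡r N≡-1 u≡1 = mod-≡0⇒≡ (subst (λ t → t ≡ 0ℚ [mod p ^ 4 ]) (sym factor)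
    (mod-*-≡0 (mod-*-≡0 (mod-*-≡0 d≡0 d≡0) d≡0) (mod-trans (mod-*ˡ (w * w) w²∈ T≡0) (mod-reflexive (*-zeroʳ (w * w))))))
    where
      R = ℕtoℚ r
      w = 1/[1+ r ]
      w∈ = InZp-1/[1+] 1+r<p
      w²∈ = InZp-* w w w∈ w∈
      d≡0 : a - R ≡ 0ℚ [mod p ^ 1 ]
      d≡0 = mod-trans (mod-minus a≡r mod-refl) (mod-reflexive (+-inverseʳ R))
      X = a + a + 1ℚ - N
      X≡ : X ≡ R + R + 1ℚ - - 1ℚ [mod p ^ 1 ]
      X≡ = mod-minus (mod-+ (mod-+ a≡r a≡r) (mod-refl {x = 1ℚ})) N≡-1
      a∈ = InZp-mod (InZp-ℕ r) a≡r
      N∈ = InZp-mod (InZp-neg 1ℚ (InZp-ℕ 1)) N≡-1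
      X∈ = InZp-+ (a + a + 1ℚ) (- N) (InZp-+ (a + a) 1ℚ (InZp-+ a a a∈ a∈) (InZp-ℕ 1)) (InZp-neg N N∈)
      double : ∀ R w → (R + R + 1ℚ - - 1ℚ) * w ≡ ℕtoℚ 2 * (w * (1ℚ + R))
      double = solve-∀ ℚ-ring
      Xw≡2 : X * w ≡ ℕtoℚ 2 [mod p ^ 1 ]
      Xw≡2 = mod-trans (mod-* X∈ w∈ X≡ mod-refl)
        (mod-reflexive (trans (double R w) (trans (cong (ℕtoℚ 2 *_) (1/[1+n]*[1+n]≡1 r)) (*-identityʳ (ℕtoℚ 2)))))
      T = X * w * cube u - ℕtoℚ 2
      T≡0 : T ≡ 0ℚ [mod p ^ 1 ]
      T≡0 = mod-trans (mod-minus (mod-* (InZp-* X w X∈ w∈) (InZp-ℕ 1) Xw≡2 (mod-*-≡1 (mod-*-≡1 u≡1 u≡1) u≡1)) (mod-refl {x = ℕtoℚ 2}))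
                      (mod-reflexive refl)
      identity : ∀ a R N w u →
        let d = a - R in
        (a + a + 1ℚ - N) * ((d * w * u) * (d * w * u) * (d * w * u)) - ℕtoℚ 2 * (d * d * d) * (w * w)
          ≡ d * d * d * (w * w * ((a + a + 1ℚ - N) * w * (u * u * u) - ℕtoℚ 2))
      identity = solve-∀ ℚ-ring
      factor = identity a R N w u

  ≢-1⇒1+r<p : ∀ {a r} → r < p → ¬ (a ≡ - 1ℚ [mod p ^ 1 ]) → a ≡ ℕtoℚ r [mod p ^ 1 ] → suc r < p
  ≢-1⇒1+r<p r<p a≢-1 a≡r = ℕₚ.≤∧≢⇒< r<p (λ 1+r≡p → a≢-1 (mod-trans a≡r (ℕtoℚ-pred≡-1 1+r≡p)))

  Cp-pair-congruence : ∀ {a r} → suc r < p → a ≡ ℕtoℚ r [mod p ^ 1 ] →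
    Cp p a + Cp p (a + 1ℚ) ≡ ℕtoℚ 2 * cube (a - ℕtoℚ r) * (1/[1+ r ] * 1/[1+ r ]) [mod p ^ 4 ]
  Cp-pair-congruence {a} {r} 1+r<p a≡r =
    let u , u≡1 , binom≡ = binom[p-1]-factorisation a r m p≡ a≡r
    in subst (λ t → t ≡ _ [mod p ^ 4 ]) (sym (Cp≡ u binom≡))
             (Cp-pair-residue 1+r<p a≡r (ℕtoℚ-pred≡-1 p≡) u≡1)
    where
      m = p ∸ suc (suc r)
      p≡ : suc (suc r ℕ.+ m) ≡ p
      p≡ = ℕₚ.m+[n∸m]≡n 1+r<p
      Cp≡ : ∀ u → binom a (suc r ℕ.+ m) ≡ (a - ℕtoℚ r) * 1/[1+ r ] * u →
            Cp p a + Cp p (a + 1ℚ) ≡ (a + a + 1ℚ - ℕtoℚ (suc r ℕ.+ m)) * cube ((a - ℕtoℚ r) * 1/[1+ r ] * u)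
      Cp≡ u binom≡ = begin
        Cp p a + Cp p (a + 1ℚ)
          ≡⟨ cong (λ n → Cp n a + Cp n (a + 1ℚ)) (sym p≡) ⟩
        Cp (suc (suc r ℕ.+ m)) a + Cp (suc (suc r ℕ.+ m)) (a + 1ℚ)
          ≡⟨ Cp-pair a (suc r ℕ.+ m) ⟩
        (a + a + 1ℚ - ℕtoℚ (suc r ℕ.+ m)) * cube (binom a (suc r ℕ.+ m))
          ≡⟨ cong (λ b → (a + a + 1ℚ - ℕtoℚ (suc r ℕ.+ m)) * cube b) binom≡ ⟩
        (a + a + 1ℚ - ℕtoℚ (suc r ℕ.+ m)) * cube ((a - ℕtoℚ r) * 1/[1+ r ] * u) ∎
        where open ≡-Reasoning

lemma4p1 : (p : ℕ) → Prime p → p ≢ 2 →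
             (a : ℚ) → InZp p a → ¬ CongMod p 1 a (-[1+ 0 ] / 1) →
             (r : ℕ) → r < p → CongMod p 1 a (ℕtoℚ r) →
             CongMod p 4 (Cp p a + Cp p (a + 1ℚ))
               (ℕtoℚ 2 * ((a - ℕtoℚ r) * (a - ℕtoℚ r) * (a - ℕtoℚ r))
                 * ((+ 1 / suc r) * (+ 1 / suc r)))
lemma4p1 p p-prime _ a _ a≢-1 r r<p a≡r =
  congMod (Cp-pair-congruence {a} (≢-1⇒1+r<p {a} r<p (λ a≡-1 → a≢-1 (congMod a≡-1)) ⟦ a≡r ⟧) ⟦ a≡r ⟧)
  where open ModPrime p p-prime
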